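{- Let $t\geq 3$ be fixed and let $\mathcal{G}$ be the class of $\{K_{1,t},\text{diamond}\}$-free graphs. Let $G$ be a graph with no induced diamond but with at least one induced $K_{1,t}$. Let $S\subseteq V(G)$ be an independent set of $G$ such that $G\oplus S\in\mathcal{G}$. Let $r$ be the center of any induced $K_{1,t}$ in $G$, and let $I$ be the set of isolated vertices of the subgraph of $G$ induced by $N(r)$. Then $S\subseteq I$ and $|S|\geq |I|-t+2$.
   Context: All graphs are finite and simple. $N(r)$ is the open neighborhood of $r$ in $G$. For a graph $G$ and $S\subseteq V(G)$, $G\oplus S$ is the graph on $V(G)$ obtained by complementing the subgraph induced by $S$: $uv$ is an edge of $G\oplus S$ iff either $u,v\in S$ and $uv$ is a nonedge of $G$, or $uv$ is an edge of $G$ and $\{u,v\}\setminus S\neq\emptyset$. The diamond is $K_4$ minus one edge. $K_{1,t}$ is the star with a center (the vertex of degree $t$) and $t$ leaves. A graph is $\mathcal{H}$-free if it has no induced subgraph isomorphic to a member of $\mathcal{H}$. -}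

module Defs where

open import Data.Nat using (ℕ; zero; suc)
open import Data.Bool using (Bool; true; false; _∧_; _∨_; not; if_then_else_)
open import Data.Fin using (Fin; zero; suc)
open import Data.Fin.Properties using (_≟_)
open import Data.Fin.Subset using (Subset; _∈_; inside)
open import Data.Vec using (tabulate; lookup)
open import Data.Product using (Σ; _×_; ∃)
open import Relation.Nullary using (¬_; does)
open import Relation.Binary.PropositionalEquality using (_≡_)
open import Function.Definitions using (Injective)

-- A (finite simple) graph on vertex set Fin n is given by a Boolean adjacency
-- function; simplicity (symmetry, irreflexivity) is imposed as hypotheses.
Adjacency : ℕ → Set
Adjacency n = Fin n → Fin n → Bool

IsSimple : {n : ℕ} → Adjacency n → Set
IsSimple {n} adj = (∀ (u v : Fin n) → adj u v ≡ adj v u) × (∀ (u : Fin n) → adj u u ≡ false)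

InducedEmbedding : {k n : ℕ} → Adjacency k → Adjacency n → (Fin k → Fin n) → Set
InducedEmbedding {k} {n} H G f =
  Injective _≡_ _≡_ f × (∀ (i j : Fin k) → H i j ≡ G (f i) (f j))

HasInduced : {k n : ℕ} → Adjacency k → Adjacency n → Set
HasInduced {k} {n} H G = Σ (Fin k → Fin n) (λ f → InducedEmbedding H G f)

isZero : {m : ℕ} → Fin m → Bool
isZero zero    = true
isZero (suc _) = false

star : (t : ℕ) → Adjacency (suc t)
star t i j = (isZero i ∧ not (isZero j)) ∨ (isZero j ∧ not (isZero i))

diamond : Adjacency 4
diamond i j = not (does (i ≟ j)) ∧ not (isPair i j)
  where
  isPair : Fin 4 → Fin 4 → Bool
  isPair (suc (suc zero)) (suc (suc (suc zero))) = true
  isPair (suc (suc (suc zero))) (suc (suc zero)) = true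
  isPair _ _ = false

InClassG : (t : ℕ) {n : ℕ} → Adjacency n → Set
InClassG t G = ¬ HasInduced (star t) G × ¬ HasInduced diamond G

-- G ⊕ S: complement the subgraph induced by S (keeping the graph loopless).
_⊕_ : {n : ℕ} → Adjacency n → Subset n → Adjacency n
(G ⊕ S) u v =
  if does (u ≟ v) then false
  else (if lookup S u ∧ lookup S v then not (G u v) else G u v)

Independent : {n : ℕ} → Adjacency n → Subset n → Set
Independent {n} G S = ∀ (u v : Fin n) → u ∈ S → v ∈ S → G u v ≡ false

IsStarCenter : (t : ℕ) {n : ℕ} → Adjacency n → Fin n → Set
IsStarCenter t G r =
  Σ (Fin (suc t) → _) (λ f → InducedEmbedding (star t) G f × f zero ≡ r)

anyFin : {n : ℕ} → (Fin n → Bool) → Bool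
anyFin {zero}  p = false
anyFin {suc n} p = p zero ∨ anyFin (λ i → p (suc i))

isolatedInNbhd : {n : ℕ} → Adjacency n → Fin n → Subset n
isolatedInNbhd G r =
  tabulate (λ v → G r v ∧ not (anyFin (λ w → G r w ∧ G v w)))

{-# OPTIONS --safe #-}
module Submission where

-- As S is independent, G ⊕ S turns S into a clique and keeps every pair with an endpoint outside S,
-- so an induced star of G meeting S at most once survives in G ⊕ S. For the star at r this forces
-- r ∉ S and two leaves l₁, l₂ ∈ S. Every s ∈ S is then adjacent to r (else l₁, l₂, r, s is a diamond
-- of G ⊕ S) and has no common neighbour with r, so S ⊆ I. Since I is an independent subset of N(r),
-- l₁ together with t − 1 vertices of I ─ S would be the leaves of a star at r surviving in G ⊕ S.

open import Defs
open import Data.Nat using (ℕ; _≤_; _+_; _∸_; zero; suc; z≤n; s≤s)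
open import Data.Nat.Properties using (+-suc; +-comm; +-monoˡ-≤; +-monoʳ-≤; n≤1+n; ≤-trans; ≮⇒≥; module ≤-Reasoning)
open import Data.Bool using (Bool; true; false; _∧_; not)
open import Data.Bool.Properties using (¬-not; not-injective; ∧-comm) renaming (_≟_ to _≟ᵇ_)
open import Data.Fin using (Fin; zero; suc)
open import Data.Fin.Properties using (_≟_; any?; suc-injective)
open import Data.Fin.Subset using (Subset; _⊆_; ∣_∣; _─_; _∈_; inside; outside)
open import Data.Fin.Subset.Properties using (p─q⊆p)
open import Data.Vec using ([]; _∷_; here; there; lookup)
open import Data.Vec.Properties using (lookup∘tabulate; []=⇒lookup; lookup⇒[]=)
open import Data.Vec.Functional using () renaming (_∷_ to _∷ᶠ_)
open import Data.Product using (_×_; _,_; proj₁; proj₂; Σ; ∃₂)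
open import Data.Empty using (⊥; ⊥-elim)
open import Function using (_∘_)
open import Function.Definitions using (Injective)
open import Relation.Nullary using (¬_; yes; no; contradiction)
open import Relation.Nullary.Decidable using (¬?; _×-dec_)
open import Relation.Binary.PropositionalEquality

∧≡true⇒ : ∀ {a b} → a ∧ b ≡ true → a ≡ true × b ≡ true
∧≡true⇒ {true} {true} _ = refl , refl

separated-by : ∀ {A : Set} (F : A → Bool) {u v} → F u ≡ true → F v ≡ false → u ≢ v
separated-by F Fu Fv refl = contradiction (trans (sym Fu) Fv) λ ()

anyFin≡false⁺ : ∀ {n} (p : Fin n → Bool) → (∀ w → p w ≡ false) → anyFin p ≡ false
anyFin≡false⁺ {zero}  p _ = refl
anyFin≡false⁺ {suc n} p h rewrite h zero = anyFin≡false⁺ (p ∘ suc) (h ∘ suc)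

anyFin≡false⁻ : ∀ {n} (p : Fin n → Bool) → anyFin p ≡ false → ∀ w → p w ≡ false
anyFin≡false⁻ p e zero with p zero | e
... | false | _  = refl
... | true  | ()
anyFin≡false⁻ p e (suc w) with p zero | e
... | false | e′ = anyFin≡false⁻ (p ∘ suc) e′ w
... | true  | ()

∷ᶠ-injective : ∀ {n k} {x : Fin n} {h : Fin k → Fin n} →
               (∀ i → x ≢ h i) → Injective _≡_ _≡_ h → Injective _≡_ _≡_ (x ∷ᶠ h)
∷ᶠ-injective x∉h h-inj {zero}  {zero}  _ = refl
∷ᶠ-injective x∉h h-inj {zero}  {suc j} e = contradiction e (x∉h j)
∷ᶠ-injective x∉h h-inj {suc i} {zero}  e = contradiction (sym e) (x∉h i)
∷ᶠ-injective x∉h h-inj {suc i} {suc j} e = cong suc (h-inj e)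

∣p∣≤∣p─q∣+∣q∣ : ∀ {n} (p q : Subset n) → ∣ p ∣ ≤ ∣ p ─ q ∣ + ∣ q ∣
∣p∣≤∣p─q∣+∣q∣ []            []            = z≤n
∣p∣≤∣p─q∣+∣q∣ (inside  ∷ p) (inside  ∷ q) = subst (suc ∣ p ∣ ≤_) (sym (+-suc _ _)) (s≤s (∣p∣≤∣p─q∣+∣q∣ p q))
∣p∣≤∣p─q∣+∣q∣ (inside  ∷ p) (outside ∷ q) = s≤s (∣p∣≤∣p─q∣+∣q∣ p q)
∣p∣≤∣p─q∣+∣q∣ (outside ∷ p) (inside  ∷ q) = ≤-trans (∣p∣≤∣p─q∣+∣q∣ p q) (+-monoʳ-≤ ∣ p ─ q ∣ (n≤1+n _))
∣p∣≤∣p─q∣+∣q∣ (outside ∷ p) (outside ∷ q) = ∣p∣≤∣p─q∣+∣q∣ p q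

x∈p─q⇒q[x]≡false : ∀ {n} (p q : Subset n) {x} → x ∈ p ─ q → lookup q x ≡ false
x∈p─q⇒q[x]≡false (inside  ∷ p) (outside ∷ q) here       = refl
x∈p─q⇒q[x]≡false (_       ∷ p) (_       ∷ q) (there x∈) = x∈p─q⇒q[x]≡false p q x∈
x∈p─q⇒q[x]≡false (outside ∷ p) (outside ∷ q) {zero} ()

distinct-members : ∀ {n k} (p : Subset n) → k ≤ ∣ p ∣ →
                   Σ (Fin k → Fin n) λ h → Injective _≡_ _≡_ h × (∀ i → h i ∈ p)
distinct-members {k = zero} p _ = (λ ()) , (λ {i} _ → contradiction i λ ()) , λ ()
distinct-members {k = suc k} (outside ∷ p) k≤∣p∣ with distinct-members p k≤∣p∣
... | h , h-inj , h∈p = suc ∘ h , h-inj ∘ suc-injective , there ∘ h∈p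
distinct-members {k = suc k} (inside ∷ p) (s≤s k≤∣p∣) with distinct-members p k≤∣p∣
... | h , h-inj , h∈p =
  zero ∷ᶠ suc ∘ h , ∷ᶠ-injective (λ _ ()) (h-inj ∘ suc-injective) , λ { zero → here ; (suc i) → there (h∈p i) }

module _ {n : ℕ} (G : Adjacency n) (r : Fin n) where

  private
    I : Subset n
    I = isolatedInNbhd G r

  isolated⁺ : ∀ {v} → G r v ≡ true → (∀ w → G r w ≡ true → G v w ≡ false) → lookup I v ≡ true
  isolated⁺ {v} r~v v≁N[r] =
    trans (lookup∘tabulate _ v) (cong₂ (λ a b → a ∧ not b) r~v (anyFin≡false⁺ _ no-common))
    where
    no-common : ∀ w → G r w ∧ G v w ≡ false
    no-common w with G r w in r~w
    ... | false = refl
    ... | true  = v≁N[r] w r~w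

  private
    isolated⁻ : ∀ {v} → lookup I v ≡ true → G r v ≡ true × anyFin (λ w → G r w ∧ G v w) ≡ false
    isolated⁻ {v} v∈I with ∧≡true⇒ (trans (sym (lookup∘tabulate _ v)) v∈I)
    ... | r~v , no-common = r~v , not-injective no-common

  isolated⇒adjacent : ∀ {v} → lookup I v ≡ true → G r v ≡ true
  isolated⇒adjacent = proj₁ ∘ isolated⁻

  isolated-independent : ∀ {u v} → lookup I u ≡ true → lookup I v ≡ true → G u v ≡ false
  isolated-independent {u} {v} u∈I v∈I =
    subst (λ b → b ∧ G u v ≡ false) (isolated⇒adjacent v∈I) (anyFin≡false⁻ _ (proj₂ (isolated⁻ u∈I)) v)

module _ {n : ℕ} {G : Adjacency n} (simple : IsSimple G) where

  private
    G-sym : ∀ u v → G u v ≡ G v u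
    G-sym = proj₁ simple

    G-irrefl : ∀ u → G u u ≡ false
    G-irrefl = proj₂ simple

  induced-embedding : ∀ {k} {K : Adjacency k} (f : Fin k → Fin n) →
                      (∀ i j → K i j ≡ G (f i) (f j)) →
                      (∀ {i j} → K i j ≡ false → f i ≡ f j → i ≡ j) →
                      InducedEmbedding K G f
  induced-embedding f adj nonadjacent-injective = inj , adj
    where
    inj : Injective _≡_ _≡_ f
    inj {i} {j} fi≡fj =
      nonadjacent-injective (trans (adj i j) (trans (cong (G (f i)) (sym fi≡fj)) (G-irrefl (f i)))) fi≡fj

  induced-star : ∀ {k} (c : Fin n) (g : Fin k → Fin n) → Injective _≡_ _≡_ g →
                 (∀ i → G c (g i) ≡ true) → (∀ i j → G (g i) (g j) ≡ false) →
                 InducedEmbedding (star k) G (c ∷ᶠ g)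
  induced-star c g g-inj c~g g-indep = induced-embedding (c ∷ᶠ g) adj nonadjacent-injective
    where
    adj : ∀ i j → star _ i j ≡ G ((c ∷ᶠ g) i) ((c ∷ᶠ g) j)
    adj zero    zero    = sym (G-irrefl c)
    adj zero    (suc j) = sym (c~g j)
    adj (suc i) zero    = sym (trans (G-sym (g i) c) (c~g i))
    adj (suc i) (suc j) = sym (g-indep i j)
    nonadjacent-injective : ∀ {i j} → star _ i j ≡ false → (c ∷ᶠ g) i ≡ (c ∷ᶠ g) j → i ≡ j
    nonadjacent-injective {zero}  {zero}  _ _ = refl
    nonadjacent-injective {suc i} {suc j} _ e = cong suc (g-inj e)

  induced-diamond : ∀ a b c d → G a b ≡ true → G a c ≡ true → G a d ≡ true →
                    G b c ≡ true → G b d ≡ true → G c d ≡ false → c ≢ d → HasInduced diamond G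
  induced-diamond a b c d ab ac ad bc bd cd c≢d = f , induced-embedding f adj nonadjacent-injective
    where
    f : Fin 4 → Fin n
    f = lookup (a ∷ b ∷ c ∷ d ∷ [])
    ⟨_⟩ : ∀ {u v} → G u v ≡ true → G v u ≡ true
    ⟨_⟩ {u} {v} uv = trans (G-sym v u) uv
    adj : ∀ i j → diamond i j ≡ G (f i) (f j)
    adj zero                   zero                   = sym (G-irrefl a)
    adj zero                   (suc zero)             = sym ab
    adj zero                   (suc (suc zero))       = sym ac
    adj zero                   (suc (suc (suc zero))) = sym ad
    adj (suc zero)             zero                   = sym ⟨ ab ⟩
    adj (suc zero)             (suc zero)             = sym (G-irrefl b)
    adj (suc zero)             (suc (suc zero))       = sym bc
    adj (suc zero)             (suc (suc (suc zero))) = sym bd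
    adj (suc (suc zero))       zero                   = sym ⟨ ac ⟩
    adj (suc (suc zero))       (suc zero)             = sym ⟨ bc ⟩
    adj (suc (suc zero))       (suc (suc zero))       = sym (G-irrefl c)
    adj (suc (suc zero))       (suc (suc (suc zero))) = sym cd
    adj (suc (suc (suc zero))) zero                   = sym ⟨ ad ⟩
    adj (suc (suc (suc zero))) (suc zero)             = sym ⟨ bd ⟩
    adj (suc (suc (suc zero))) (suc (suc zero))       = sym (trans (G-sym d c) cd)
    adj (suc (suc (suc zero))) (suc (suc (suc zero))) = sym (G-irrefl d)
    nonadjacent-injective : ∀ {i j} → diamond i j ≡ false → f i ≡ f j → i ≡ j
    nonadjacent-injective {zero}                   {zero}                   _ _ = refl
    nonadjacent-injective {suc zero}               {suc zero}               _ _ = refl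
    nonadjacent-injective {suc (suc zero)}         {suc (suc zero)}         _ _ = refl
    nonadjacent-injective {suc (suc (suc zero))}   {suc (suc (suc zero))}   _ _ = refl
    nonadjacent-injective {suc (suc zero)}         {suc (suc (suc zero))}   _ e = contradiction e c≢d
    nonadjacent-injective {suc (suc (suc zero))}   {suc (suc zero)}         _ e = contradiction (sym e) c≢d

module _ {n : ℕ} {G : Adjacency n} (simple : IsSimple G) (S : Subset n) where

  private
    G-irrefl : ∀ u → G u u ≡ false
    G-irrefl = proj₂ simple

  ⊕-irrefl : ∀ u → (G ⊕ S) u u ≡ false
  ⊕-irrefl u with u ≟ u
  ... | yes _  = refl
  ... | no u≢u = contradiction refl u≢u

  ⊕-sym : ∀ u v → (G ⊕ S) u v ≡ (G ⊕ S) v u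
  ⊕-sym u v with u ≟ v | v ≟ u
  ... | yes _   | yes _   = refl
  ... | yes u≡v | no v≢u  = contradiction (sym u≡v) v≢u
  ... | no u≢v  | yes v≡u = contradiction (sym v≡u) u≢v
  ... | no _    | no _ rewrite ∧-comm (lookup S u) (lookup S v) | proj₁ simple u v = refl

  ⊕-simple : IsSimple (G ⊕ S)
  ⊕-simple = ⊕-sym , ⊕-irrefl

  ⊕-agrees : ∀ {u v} → lookup S u ∧ lookup S v ≡ false → (G ⊕ S) u v ≡ G u v
  ⊕-agrees {u} {v} not-both with u ≟ v
  ... | yes refl = sym (G-irrefl u)
  ... | no _ rewrite not-both = refl

  ⊕-agreesˡ : ∀ {u v} → lookup S u ≡ false → (G ⊕ S) u v ≡ G u v
  ⊕-agreesˡ u∉S = ⊕-agrees (cong (_∧ _) u∉S)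

  ⊕-agreesʳ : ∀ {u v} → lookup S v ≡ false → (G ⊕ S) u v ≡ G u v
  ⊕-agreesʳ {u} {v} v∉S = trans (⊕-sym u v) (trans (⊕-agreesˡ v∉S) (proj₁ simple v u))

  ⊕-complements : ∀ {u v} → u ≢ v → lookup S u ≡ true → lookup S v ≡ true → (G ⊕ S) u v ≡ not (G u v)
  ⊕-complements {u} {v} u≢v u∈S v∈S with u ≟ v
  ... | yes u≡v = contradiction u≡v u≢v
  ... | no _ rewrite u∈S | v∈S = refl

  ⊕-preserves-embedding : ∀ {k} {K : Adjacency k} {f : Fin k → Fin n} → InducedEmbedding K G f →
                          (∀ i j → lookup S (f i) ≡ true → lookup S (f j) ≡ true → i ≡ j) →
                          InducedEmbedding K (G ⊕ S) f
  ⊕-preserves-embedding {K = K} {f} (f-inj , f-adj) meets-S-once = f-inj , λ i j → trans (f-adj i j) (sym (agrees i j))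
    where
    agrees : ∀ i j → (G ⊕ S) (f i) (f j) ≡ G (f i) (f j)
    agrees i j with i ≟ j
    ... | yes refl = trans (⊕-irrefl (f i)) (sym (G-irrefl (f i)))
    ... | no  i≢j  = ⊕-agrees (¬-not λ both → i≢j (meets-S-once i j (proj₁ (∧≡true⇒ both)) (proj₂ (∧≡true⇒ both))))

module _ {k n : ℕ} {G : Adjacency n} (simple : IsSimple G) (G-diamond-free : ¬ HasInduced diamond G)
         {S : Subset n} (S-independent : Independent G S) (G⊕S∈𝒢 : InClassG (suc (suc k)) (G ⊕ S)) where

  private
    t : ℕ
    t = suc (suc k)

    H : Adjacency n
    H = G ⊕ S

    G-sym : ∀ u v → G u v ≡ G v u
    G-sym = proj₁ simple

    independent : ∀ {u v} → lookup S u ≡ true → lookup S v ≡ true → G u v ≡ false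
    independent {u} {v} u∈S v∈S = S-independent u v (lookup⇒[]= u S u∈S) (lookup⇒[]= v S v∈S)

    clique : ∀ {u v} → u ≢ v → lookup S u ≡ true → lookup S v ≡ true → H u v ≡ true
    clique u≢v u∈S v∈S = trans (⊕-complements simple S u≢v u∈S v∈S) (cong not (independent u∈S v∈S))

    no-star-in-H : ∀ {f} → InducedEmbedding (star t) G f →
                   ¬ (∀ i j → lookup S (f i) ≡ true → lookup S (f j) ≡ true → i ≡ j)
    no-star-in-H {f} emb meets-S-once = proj₁ G⊕S∈𝒢 (f , ⊕-preserves-embedding simple S emb meets-S-once)

  module _ {f : Fin (suc t) → Fin n} (emb : InducedEmbedding (star t) G f) where

    star-center~leaf : ∀ i → G (f zero) (f (suc i)) ≡ true
    star-center~leaf i = sym (proj₂ emb zero (suc i))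

    star-center∉S : lookup S (f zero) ≡ false
    star-center∉S = ¬-not λ center∈S → no-star-in-H emb λ
      { zero    zero    _   _   → refl
      ; zero    (suc j) _   j∈S → leaf∉S center∈S j j∈S
      ; (suc i) _       i∈S _   → leaf∉S center∈S i i∈S }
      where
      leaf∉S : ∀ {A : Set} → lookup S (f zero) ≡ true → ∀ i → lookup S (f (suc i)) ≡ true → A
      leaf∉S center∈S i i∈S = contradiction (trans (sym (star-center~leaf i)) (independent center∈S i∈S)) λ ()

    two-leaves-in-S : ∃₂ λ i j → i ≢ j × lookup S (f (suc i)) ≡ true × lookup S (f (suc j)) ≡ true
    two-leaves-in-S with any? (λ i → any? (λ j →
                           ¬? (i ≟ j) ×-dec (lookup S (f (suc i)) ≟ᵇ true) ×-dec (lookup S (f (suc j)) ≟ᵇ true)))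
    ... | yes found = found
    ... | no  none  = ⊥-elim (no-star-in-H emb meets-S-once)
      where
      meets-S-once : ∀ i j → lookup S (f i) ≡ true → lookup S (f j) ≡ true → i ≡ j
      meets-S-once zero    _       center∈S _ = contradiction (trans (sym center∈S) star-center∉S) λ ()
      meets-S-once (suc i) zero    _ center∈S = contradiction (trans (sym center∈S) star-center∉S) λ ()
      meets-S-once (suc i) (suc j) i∈S j∈S with i ≟ j
      ... | yes i≡j = cong suc i≡j
      ... | no  i≢j = ⊥-elim (none (i , j , i≢j , i∈S , j∈S))

  module TwoNeighboursInS {r l₁ l₂ : Fin n} (r∉S : lookup S r ≡ false) (l₁∈S : lookup S l₁ ≡ true) (l₂∈S : lookup S l₂ ≡ true)
           (l₁≢l₂ : l₁ ≢ l₂) (r~l₁ : G r l₁ ≡ true) (r~l₂ : G r l₂ ≡ true) where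

    private
      I : Subset n
      I = isolatedInNbhd G r

      H-at-r : ∀ {v} → H r v ≡ G r v
      H-at-r = ⊕-agreesˡ simple S r∉S

      H-to-r : ∀ {v} → H v r ≡ G r v
      H-to-r {v} = trans (⊕-agreesʳ simple S r∉S) (G-sym v r)

      ∈S⇒≢r : ∀ {s} → lookup S s ≡ true → s ≢ r
      ∈S⇒≢r s∈S = separated-by (lookup S) s∈S r∉S

    S⊆N[r] : ∀ {s} → lookup S s ≡ true → G r s ≡ true
    S⊆N[r] {s} s∈S = ¬-not λ r≁s →
      let s≢lᵢ : ∀ {l} → G r l ≡ true → s ≢ l
          s≢lᵢ r~l = separated-by (G r) r~l r≁s ∘ sym
      in proj₂ G⊕S∈𝒢 (induced-diamond (⊕-simple simple S) l₁ l₂ r s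
           (clique l₁≢l₂ l₁∈S l₂∈S) (trans H-to-r r~l₁) (clique (s≢lᵢ r~l₁ ∘ sym) l₁∈S s∈S)
           (trans H-to-r r~l₂) (clique (s≢lᵢ r~l₂ ∘ sym) l₂∈S s∈S)
           (trans H-at-r r≁s) (∈S⇒≢r s∈S ∘ sym))

    private
      module MissedNeighbour {s w} (s∈S : lookup S s ≡ true) (r~w : G r w ≡ true) (s~w : G s w ≡ true) where

        w∉S : lookup S w ≡ false
        w∉S = ¬-not λ w∈S → contradiction (trans (sym s~w) (independent s∈S w∈S)) λ ()

        misses : ∀ {l} → lookup S l ≡ true → G r l ≡ true → G w l ≡ false → ⊥
        misses {l} l∈S r~l w≁l with l ≟ s
        ... | yes refl = contradiction (trans (sym s~w) (trans (G-sym l w) w≁l)) λ ()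
        ... | no  l≢s  = proj₂ G⊕S∈𝒢 (induced-diamond (⊕-simple simple S) r s w l
              (trans H-at-r (S⊆N[r] s∈S)) (trans H-at-r r~w) (trans H-at-r r~l)
              (trans (⊕-agreesʳ simple S w∉S) s~w) (clique (l≢s ∘ sym) s∈S l∈S)
              (trans (⊕-agreesˡ simple S w∉S) w≁l) (separated-by (lookup S) l∈S w∉S ∘ sym))

    -- A common neighbour w of r and s misses some lᵢ (else r, w, l₁, l₂ is a diamond of G);
    -- then r, s, w, lᵢ is a diamond of G ⊕ S whose missing edge is wlᵢ.
    S-no-common-neighbour : ∀ {s w} → lookup S s ≡ true → G r w ≡ true → G s w ≡ true → ⊥
    S-no-common-neighbour {s} {w} s∈S r~w s~w with G w l₁ in w~l₁ | G w l₂ in w~l₂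
    ... | true  | true  = G-diamond-free (induced-diamond simple r w l₁ l₂ r~w r~l₁ r~l₂ w~l₁ w~l₂ (independent l₁∈S l₂∈S) l₁≢l₂)
    ... | false | _     = misses l₁∈S r~l₁ w~l₁
      where open MissedNeighbour s∈S r~w s~w
    ... | true  | false = misses l₂∈S r~l₂ w~l₂
      where open MissedNeighbour s∈S r~w s~w

    S⊆I : S ⊆ I
    S⊆I {s} s∈S = lookup⇒[]= s I (isolated⁺ G r (S⊆N[r] s∈Sᵇ) λ w r~w → ¬-not (S-no-common-neighbour s∈Sᵇ r~w))
      where
      s∈Sᵇ : lookup S s ≡ true
      s∈Sᵇ = []=⇒lookup s∈S

    private
      no-k+1-members-outside-S : (h : Fin (suc k) → Fin n) → Injective _≡_ _≡_ h → (∀ i → h i ∈ I ─ S) → ⊥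
      no-k+1-members-outside-S h h-inj h∈I─S =
        no-star-in-H
          (induced-star simple r leaves leaves-inj (isolated⇒adjacent G r ∘ leaves∈I)
                        (λ i j → isolated-independent G r (leaves∈I i) (leaves∈I j)))
          (λ i j i∈S j∈S → trans (only-l₁∈S i i∈S) (sym (only-l₁∈S j j∈S)))
        where
        h∉S : ∀ i → lookup S (h i) ≡ false
        h∉S i = x∈p─q⇒q[x]≡false I S (h∈I─S i)
        leaves : Fin t → Fin n
        leaves = l₁ ∷ᶠ h
        leaves∈I : ∀ i → lookup I (leaves i) ≡ true
        leaves∈I zero    = []=⇒lookup (S⊆I (lookup⇒[]= l₁ S l₁∈S))
        leaves∈I (suc i) = []=⇒lookup (p─q⊆p I S (h∈I─S i))
        leaves-inj : Injective _≡_ _≡_ leaves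
        leaves-inj = ∷ᶠ-injective (λ i → separated-by (lookup S) l₁∈S (h∉S i)) h-inj
        only-l₁∈S : ∀ i → lookup S ((r ∷ᶠ leaves) i) ≡ true → i ≡ suc zero
        only-l₁∈S zero          r∈S = contradiction (trans (sym r∈S) r∉S) λ ()
        only-l₁∈S (suc zero)    _   = refl
        only-l₁∈S (suc (suc i)) h∈S = contradiction (trans (sym h∈S) (h∉S i)) λ ()

    ∣I─S∣≤k : ∣ I ─ S ∣ ≤ k
    ∣I─S∣≤k = ≮⇒≥ λ k<∣I─S∣ →
      let (h , h-inj , h∈I─S) = distinct-members (I ─ S) k<∣I─S∣
      in no-k+1-members-outside-S h h-inj h∈I─S

    ∣I∣≤∣S∣+k : ∣ I ∣ ≤ ∣ S ∣ + k
    ∣I∣≤∣S∣+k = begin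
      ∣ I ∣             ≤⟨ ∣p∣≤∣p─q∣+∣q∣ I S ⟩
      ∣ I ─ S ∣ + ∣ S ∣ ≤⟨ +-monoˡ-≤ ∣ S ∣ ∣I─S∣≤k ⟩
      k + ∣ S ∣         ≡⟨ +-comm k ∣ S ∣ ⟩
      ∣ S ∣ + k         ∎
      where open ≤-Reasoning

  isolated-neighbours-of-star-center :
    ∀ {f} → InducedEmbedding (star t) G f →
    S ⊆ isolatedInNbhd G (f zero) × ∣ isolatedInNbhd G (f zero) ∣ ≤ ∣ S ∣ + k
  isolated-neighbours-of-star-center {f} emb with two-leaves-in-S emb
  ... | i , j , i≢j , i∈S , j∈S = S⊆I , ∣I∣≤∣S∣+k
    where
    open TwoNeighboursInS (star-center∉S emb) i∈S j∈S (i≢j ∘ suc-injective ∘ proj₁ emb)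
                          (star-center~leaf emb i) (star-center~leaf emb j)

-- The hypothesis HasInduced (star t) G is implied by IsStarCenter, and t ≥ 2 would suffice.
lemma3 : (t : ℕ) → 3 ≤ t → (n : ℕ) → (G : Adjacency n) → IsSimple G →
         ¬ HasInduced diamond G → HasInduced (star t) G →
         (S : Subset n) → Independent G S → InClassG t (G ⊕ S) →
         (r : Fin n) → IsStarCenter t G r →
         (S ⊆ isolatedInNbhd G r) × (∣ isolatedInNbhd G r ∣ ≤ ∣ S ∣ + (t ∸ 2))
lemma3 (suc (suc (suc k))) (s≤s (s≤s (s≤s z≤n))) n G simple G-diamond-free _ S S-independent G⊕S∈𝒢 _ (_ , emb , refl) =
  isolated-neighbours-of-star-center simple G-diamond-free S-independent G⊕S∈𝒢 emb
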